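{- Let $k\ge2$, let $(M_1,\ldots,M_k)$ be an anarchy harmonious $k$-tuple, and suppose positive integers $U_i,V_i$ ($1\le i\le k$) are given with $M_i=U_iV_i$, $\gcd(U_i,V_i)=1$ for each $i$, and $U:=U_1\cdots U_k>1$. Then for every set $\mathcal{S}$ of prime factors of $U$, \[ \sum_{i=1}^{k}\frac{V_i}{\sigma(V_i)}\prod_{\substack{p\mid U_i\\ p\in\mathcal{S}}}\left(1-\frac{1}{p}\right)\neq1, \] where the products run over primes $p$.
   Context: $\sigma(n)$ is the sum of the positive divisors of $n$. For $k\ge2$, a tuple of distinct positive integers $(M_i)_{i=1}^k$ is anarchy if $\gcd(M_i,M_j\sigma(M_j))=1$ for all distinct $i,j$; a tuple of positive integers is harmonious if $\sum_{i=1}^k M_i/\sigma(M_i)=1$. -}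

module Defs where

open import Data.Nat using (ℕ; zero; suc; _+_; _*_; _∸_)
open import Data.Nat.Divisibility using (_∣_; _∣?_)
open import Data.Nat.Primality using (Prime; prime?)
open import Data.Nat.GCD using (gcd)
open import Data.Fin using (Fin)
open import Data.List using (List; filter; upTo; map; foldr)
open import Data.Nat.ListAction using (sum)
open import Data.List.Membership.Propositional using (_∈_)
open import Data.Integer using (+_)
open import Data.Rational using (ℚ; 0ℚ; 1ℚ; _-_) renaming (_*_ to _*ℚ_; _+_ to _+ℚ_; _/_ to _/ℚ_)
open import Relation.Nullary using (Dec; ¬_)
open import Relation.Unary using (Pred; Decidable; _∩_)
open import Relation.Binary.PropositionalEquality using (_≡_)
open import Data.Product using (_×_)
open import Level using (0ℓ)

divisors : ℕ → List ℕ
divisors n = filter (_∣? n) (map suc (upTo n))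

σ : ℕ → ℕ
σ n = sum (divisors n)

-- a / b as a rational number; only ever used with b ≥ 1 (by convention a/0 := 0)
_÷_ : ℕ → ℕ → ℚ
a ÷ zero = 0ℚ
a ÷ suc b = (+ a) /ℚ (suc b)

Σℚ : (k : ℕ) → (Fin k → ℚ) → ℚ
Σℚ zero f = 0ℚ
Σℚ (suc k) f = f Data.Fin.zero +ℚ Σℚ k (λ i → f (Data.Fin.suc i))

Πℕ : (k : ℕ) → (Fin k → ℕ) → ℕ
Πℕ zero f = 1
Πℕ (suc k) f = f Data.Fin.zero * Πℕ k (λ i → f (Data.Fin.suc i))

Πℚ : List ℚ → ℚ
Πℚ = foldr _*ℚ_ 1ℚ

Anarchy : (k : ℕ) → (Fin k → ℕ) → Set
Anarchy k M = (∀ i j → M i ≡ M j → i ≡ j) × (∀ i j → ¬ (i ≡ j) → gcd (M i) (M j * σ (M j)) ≡ 1)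

Harmonious : (k : ℕ) → (Fin k → ℕ) → Set
Harmonious k M = Σℚ k (λ i → M i ÷ σ (M i)) ≡ 1ℚ

primesIn : (S : Pred ℕ 0ℓ) → Decidable S → ℕ → List ℕ
primesIn S S? u = filter (λ p → S? p) (filter prime? (filter (_∣? u) (map suc (upTo u))))

eulerFactor : (S : Pred ℕ 0ℓ) → Decidable S → ℕ → ℚ
eulerFactor S S? u = Πℚ (map (λ p → 1ℚ - (1 ÷ p)) (primesIn S S? u))

module Submission where

-- If S is empty the Euler factors are 1, and since σ is multiplicative,
-- V i/σ(V i) ≥ (U i·V i)/σ(U i·V i) = M i/σ(M i) with strict inequality where U i ≥ 2,
-- so the sum exceeds Σ M i/σ(M i) = 1.  Otherwise let p be the largest prime of S and
-- p ∣ U i₀.  Over the common denominator Π_i σ(V i)·Π_{q} q, p divides the denominator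
-- but not the numerator: the i₀-th numerator V i₀·Π (q − 1) is prime to p, and by
-- anarchy p ∤ σ(V j)·Π q for j ≠ i₀.

open import Defs
open import Data.Nat using (ℕ; _≤_; _<_; _*_)
open import Data.Nat.Divisibility using (_∣_)
open import Data.Nat.Primality using (Prime)
open import Data.Nat.GCD using (gcd)
open import Data.Fin using (Fin)
import Data.Fin as Fin
import Data.Fin.Properties as Finₚ
open import Data.Rational using (ℚ; 1ℚ) renaming (_*_ to _*ℚ_)
open import Data.Product using (_×_)
open import Relation.Nullary using (¬_)
open import Relation.Unary using (Pred; Decidable)
open import Relation.Binary.PropositionalEquality using (_≡_)
open import Level using (0ℓ)

open import Data.Nat using (zero; suc; pred; _+_; z≤n; s≤s; >-nonZero; nonTrivial⇒n>1)
open import Data.Nat.Properties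
open import Data.Nat.Divisibility
  using (_∣?_; ∣-refl; ∣-trans; ∣-antisym; 1∣_; ∣1⇒≡1; ∣⇒≤; m∣m*n; n∣m*n; ∣m⇒∣m*n; ∣n⇒∣m*n;
         *-pres-∣; *-monoʳ-∣; ∣m+n∣m⇒∣n; quotient; m∣n⇒n≡m*quotient)
open import Data.Nat.GCD using (gcd[m,n]∣m; gcd[m,n]∣n; gcd-greatest; gcd[m,n]≢0; c*gcd[m,n]≡gcd[cm,cn])
open import Data.Nat.Coprimality using (Coprime; coprime-divisor; gcd≡1⇒coprime)
import Data.Nat.Coprimality as Coprime
open import Data.Nat.Primality using (prime?; euclidsLemma; prime⇒nonTrivial)
open import Data.Nat.ListAction using (sum; product)
open import Data.Nat.ListAction.Properties using (sum-++; ∈⇒∣product)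
open import Data.List using (List; []; _∷_; [_]; _++_; map; filter; upTo)
open import Data.List.Properties using (map-++; upTo-∷ʳ; filter-none)
open import Data.List.Membership.Propositional using (_∈_)
open import Data.List.Membership.Propositional.Properties using (∈-map⁻; ∈-filter⁺; ∈-filter⁻; ∈-map⁺; ∈-upTo⁺)
open import Data.List.Relation.Unary.Any using (here; there)
open import Data.List.Relation.Unary.All using (All; []; _∷_; tabulate; universal)
import Data.List.Relation.Unary.All as All
open import Data.Product using (∃; _,_; proj₁; proj₂)
import Data.Product as Product
open import Data.Sum using (_⊎_; inj₁; inj₂; [_,_]′)
import Data.Sum as Sum
open import Data.Empty using (⊥; ⊥-elim)
open import Function using (_∘_; id)
open import Algebra.Properties.CommutativeSemigroup +-commutativeSemigroup using (interchange)
open import Algebra.Properties.CommutativeSemigroup *-commutativeSemigroup using (x∙yz≈y∙xz)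
open import Relation.Nullary using (Dec; yes; no; _×-dec_)
import Data.Integer as ℤ
import Data.Integer.Properties as ℤₚ
import Data.Integer.GCD as ℤ
import Data.Integer.Tactic.RingSolver as ℤ-Solver
import Data.Rational as ℚ
import Data.Rational.Properties as ℚₚ
open import Data.Rational.Unnormalised using (ℚᵘ; mkℚᵘ; *≡*; *≤*; *<*)
import Data.Rational.Unnormalised as ℚᵘ
import Data.Rational.Unnormalised.Properties as ℚᵘₚ
open import Relation.Binary.PropositionalEquality using (_≢_; refl; sym; trans; cong; cong₂; subst; subst₂; module ≡-Reasoning)

rangeSum : ℕ → (ℕ → ℕ) → ℕ
rangeSum zero    f = 0
rangeSum (suc n) f = rangeSum n f + f (suc n)

rangeSum-cong : ∀ n {f g} → (∀ x → 1 ≤ x → x ≤ n → f x ≡ g x) → rangeSum n f ≡ rangeSum n g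
rangeSum-cong zero    eq = refl
rangeSum-cong (suc n) eq =
  cong₂ _+_ (rangeSum-cong n (λ x 1≤x x≤n → eq x 1≤x (m≤n⇒m≤1+n x≤n))) (eq (suc n) (s≤s z≤n) ≤-refl)

rangeSum-zero : ∀ n f → (∀ x → 1 ≤ x → x ≤ n → f x ≡ 0) → rangeSum n f ≡ 0
rangeSum-zero n f f≡0 = trans (rangeSum-cong n f≡0) (rangeSum-const0 n)
  where
  rangeSum-const0 : ∀ n → rangeSum n (λ _ → 0) ≡ 0
  rangeSum-const0 zero    = refl
  rangeSum-const0 (suc n) = cong (_+ 0) (rangeSum-const0 n)

rangeSum-single : ∀ n m f → 1 ≤ m → m ≤ n → (∀ x → x ≢ m → f x ≡ 0) → rangeSum n f ≡ f m
rangeSum-single zero    m f 1≤m m≤0 _ = ⊥-elim (<-irrefl refl (≤-trans 1≤m m≤0))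
rangeSum-single (suc n) m f 1≤m m≤1+n f≡0 with m ≟ suc n
... | yes refl = cong (_+ f (suc n)) (rangeSum-zero n f (λ x _ x≤n → f≡0 x (λ x≡m → <-irrefl x≡m (s≤s x≤n))))
... | no m≢1+n = begin
  rangeSum n f + f (suc n) ≡⟨ cong₂ _+_ (rangeSum-single n m f 1≤m m≤n f≡0) (f≡0 (suc n) (m≢1+n ∘ sym)) ⟩
  f m + 0                  ≡⟨ +-identityʳ (f m) ⟩
  f m                      ∎
  where
  open ≡-Reasoning
  m≤n : m ≤ n
  m≤n = ≤-pred (≤∧≢⇒< m≤1+n m≢1+n)

rangeSum-+ : ∀ n f g → rangeSum n (λ x → f x + g x) ≡ rangeSum n f + rangeSum n g
rangeSum-+ zero    f g = refl
rangeSum-+ (suc n) f g =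
  trans (cong (_+ (f (suc n) + g (suc n))) (rangeSum-+ n f g))
        (interchange (rangeSum n f) (rangeSum n g) (f (suc n)) (g (suc n)))

rangeSum-swap : ∀ n m (h : ℕ → ℕ → ℕ) →
                rangeSum n (λ x → rangeSum m (h x)) ≡ rangeSum m (λ y → rangeSum n (λ x → h x y))
rangeSum-swap zero    m h = sym (rangeSum-zero m _ (λ _ _ _ → refl))
rangeSum-swap (suc n) m h =
  trans (cong (_+ rangeSum m (h (suc n))) (rangeSum-swap n m h))
        (sym (rangeSum-+ m (λ y → rangeSum n (λ x → h x y)) (h (suc n))))

rangeSum-*ˡ : ∀ n f c → c * rangeSum n f ≡ rangeSum n (λ x → c * f x)
rangeSum-*ˡ zero    f c = *-zeroʳ c
rangeSum-*ˡ (suc n) f c =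
  trans (*-distribˡ-+ c (rangeSum n f) (f (suc n))) (cong (_+ c * f (suc n)) (rangeSum-*ˡ n f c))

rangeSum-*ʳ : ∀ n f c → rangeSum n f * c ≡ rangeSum n (λ x → f x * c)
rangeSum-*ʳ n f c =
  trans (*-comm (rangeSum n f) c) (trans (rangeSum-*ˡ n f c) (rangeSum-cong n (λ x _ _ → *-comm c (f x))))

term≤rangeSum : ∀ n f m → 1 ≤ m → m ≤ n → f m ≤ rangeSum n f
term≤rangeSum zero    f m 1≤m m≤0 = ⊥-elim (<-irrefl refl (≤-trans 1≤m m≤0))
term≤rangeSum (suc n) f m 1≤m m≤1+n with m ≟ suc n
... | yes refl  = m≤n+m (f (suc n)) (rangeSum n f)
... | no m≢1+n  = ≤-trans (term≤rangeSum n f m 1≤m (≤-pred (≤∧≢⇒< m≤1+n m≢1+n))) (m≤m+n (rangeSum n f) (f (suc n)))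

keepIf : {P : Set} → Dec P → ℕ → ℕ
keepIf (yes _) x = x
keepIf (no _)  x = 0

keepIf-yes : ∀ {P : Set} (P? : Dec P) x → P → keepIf P? x ≡ x
keepIf-yes (yes _) x _ = refl
keepIf-yes (no ¬p) x p = ⊥-elim (¬p p)

keepIf-no : ∀ {P : Set} (P? : Dec P) x → ¬ P → keepIf P? x ≡ 0
keepIf-no (yes p) x ¬p = ⊥-elim (¬p p)
keepIf-no (no _)  x _  = refl

divisorTerm : ℕ → ℕ → ℕ
divisorTerm n d = keepIf (d ∣? n) d

σ≡rangeSum : ∀ n → σ n ≡ rangeSum n (divisorTerm n)
σ≡rangeSum n = trans (sum-filter (map suc (upTo n))) (sum-upTo n)
  where
  sum-filter : ∀ xs → sum (filter (_∣? n) xs) ≡ sum (map (divisorTerm n) xs)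
  sum-filter []       = refl
  sum-filter (x ∷ xs) with x ∣? n
  ... | yes _ = cong (x +_) (sum-filter xs)
  ... | no _  = sum-filter xs

  sum-upTo : ∀ m → sum (map (divisorTerm n) (map suc (upTo m))) ≡ rangeSum m (divisorTerm n)
  sum-upTo zero    = refl
  sum-upTo (suc m) = begin
    sum (map f (map suc (upTo (suc m))))      ≡⟨ cong (λ l → sum (map f (map suc l))) (sym (upTo-∷ʳ m)) ⟩
    sum (map f (map suc (upTo m ++ [ m ])))   ≡⟨ cong (λ l → sum (map f l)) (map-++ suc (upTo m) [ m ]) ⟩
    sum (map f (map suc (upTo m) ++ [ suc m ])) ≡⟨ cong sum (map-++ f (map suc (upTo m)) [ suc m ]) ⟩
    sum (map f (map suc (upTo m)) ++ [ f (suc m) ]) ≡⟨ sum-++ (map f (map suc (upTo m))) [ f (suc m) ] ⟩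
    sum (map f (map suc (upTo m))) + (f (suc m) + 0) ≡⟨ cong₂ _+_ (sum-upTo m) (+-identityʳ (f (suc m))) ⟩
    rangeSum m f + f (suc m)                  ∎
    where
    open ≡-Reasoning
    f = divisorTerm n

n≤σ[n] : ∀ n → 1 ≤ n → n ≤ σ n
n≤σ[n] n 1≤n = begin
  n                        ≡⟨ sym (keepIf-yes (n ∣? n) n ∣-refl) ⟩
  divisorTerm n n          ≤⟨ term≤rangeSum n (divisorTerm n) n 1≤n ≤-refl ⟩
  rangeSum n (divisorTerm n) ≡⟨ sym (σ≡rangeSum n) ⟩
  σ n                      ∎
  where open ≤-Reasoning

n<σ[n] : ∀ n → 2 ≤ n → n < σ n
n<σ[n] (suc m) (s≤s 1≤m) = begin
  1 + suc m                              ≡⟨ sym (cong₂ _+_ (keepIf-yes (1 ∣? n) 1 (1∣ n)) (keepIf-yes (n ∣? n) n ∣-refl)) ⟩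
  divisorTerm n 1 + divisorTerm n n      ≤⟨ +-monoˡ-≤ (divisorTerm n n) (term≤rangeSum m (divisorTerm n) 1 ≤-refl 1≤m) ⟩
  rangeSum m (divisorTerm n) + divisorTerm n n ≡⟨ sym (σ≡rangeSum n) ⟩
  σ n                                    ∎
  where
  open ≤-Reasoning
  n = suc m

-- Every divisor d of U·V splits
-- uniquely as d = a·b with a ∣ U and b ∣ V, namely a = gcd d U, b = gcd d V; so
-- σ(U·V) = Σ_d Σ_a Σ_b [(a,b) splits d]·d, and summing over d first gives σ U · σ V.

gcd[ab,U]≡a : ∀ {U V a b} → Coprime U V → a ∣ U → b ∣ V → gcd (a * b) U ≡ a
gcd[ab,U]≡a {U} {V} {a} {b} U⊥V a∣U b∣V = ∣-antisym g∣a (gcd-greatest (m∣m*n b) a∣U)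
  where
  g = gcd (a * b) U
  g⊥b : Coprime g b
  g⊥b (i∣g , i∣b) = U⊥V (∣-trans i∣g (gcd[m,n]∣n (a * b) U) , ∣-trans i∣b b∣V)
  g∣a : g ∣ a
  g∣a = coprime-divisor g⊥b (subst (g ∣_) (*-comm a b) (gcd[m,n]∣m (a * b) U))

module _ {U V : ℕ} (U⊥V : Coprime U V) where

  Splits : ℕ → ℕ → ℕ → Set
  Splits a b d = a ∣ U × b ∣ V × a * b ≡ d

  split-unique : ∀ {a b d} → Splits a b d → a ≡ gcd d U × b ≡ gcd d V
  split-unique {a} {b} (a∣U , b∣V , refl) =
    sym (gcd[ab,U]≡a U⊥V a∣U b∣V) ,
    sym (trans (cong (λ x → gcd x V) (*-comm a b)) (gcd[ab,U]≡a (Coprime.sym U⊥V) b∣V a∣U))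

  split-exists : ∀ {d} → d ∣ U * V → Splits (gcd d U) (gcd d V) d
  split-exists {d} d∣UV = gcd[m,n]∣n d U , gcd[m,n]∣n d V , ∣-antisym ab∣d d∣ab
    where
    a = gcd d U
    b = gcd d V
    d∣aV : d ∣ a * V
    d∣aV = subst (d ∣_) (trans (sym (c*gcd[m,n]≡gcd[cm,cn] V d U)) (*-comm V a))
             (gcd-greatest (n∣m*n V) (subst (d ∣_) (*-comm U V) d∣UV))
    d∣ab : d ∣ a * b
    d∣ab = subst (d ∣_) (sym (c*gcd[m,n]≡gcd[cm,cn] a d V)) (gcd-greatest (n∣m*n a) d∣aV)
    a∣d : a ∣ d
    a∣d = gcd[m,n]∣m d U
    b⊥a : Coprime b a
    b⊥a (i∣b , i∣a) = U⊥V (∣-trans i∣a (gcd[m,n]∣n d U) , ∣-trans i∣b (gcd[m,n]∣n d V))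
    b∣d/a : b ∣ quotient a∣d
    b∣d/a = coprime-divisor b⊥a (subst (b ∣_) (m∣n⇒n≡m*quotient a∣d) (gcd[m,n]∣m d V))
    ab∣d : a * b ∣ d
    ab∣d = subst (a * b ∣_) (sym (m∣n⇒n≡m*quotient a∣d)) (*-monoʳ-∣ a b∣d/a)

  splits? : ∀ a b d → Dec (Splits a b d)
  splits? a b d = (a ∣? U) ×-dec ((b ∣? V) ×-dec (a * b ≟ d))

  splitTerm : ℕ → ℕ → ℕ → ℕ
  splitTerm a b d = keepIf (splits? a b d) d

  sum-over-splits : 1 ≤ U → 1 ≤ V → ∀ d → 1 ≤ d →
                    divisorTerm (U * V) d ≡ rangeSum U (λ a → rangeSum V (λ b → splitTerm a b d))
  sum-over-splits 1≤U 1≤V d 1≤d with d ∣? (U * V)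
  ... | no d∤UV = sym (rangeSum-zero U _ (λ a _ _ → rangeSum-zero V _ (λ b _ _ →
          keepIf-no (splits? a b d) d (λ (a∣U , b∣V , ab≡d) → d∤UV (subst (_∣ U * V) ab≡d (*-pres-∣ a∣U b∣V))))))
  ... | yes d∣UV = sym (begin
    rangeSum U (λ a → rangeSum V (λ b → splitTerm a b d))
      ≡⟨ rangeSum-single U a₀ _ (gcd≥1 U) (gcd≤ U 1≤U) (λ a a≢a₀ → rangeSum-zero V _ (λ b _ _ →
           keepIf-no (splits? a b d) d (a≢a₀ ∘ proj₁ ∘ split-unique))) ⟩
    rangeSum V (λ b → splitTerm a₀ b d)
      ≡⟨ rangeSum-single V b₀ _ (gcd≥1 V) (gcd≤ V 1≤V) (λ b b≢b₀ →
           keepIf-no (splits? a₀ b d) d (b≢b₀ ∘ proj₂ ∘ split-unique)) ⟩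
    splitTerm a₀ b₀ d
      ≡⟨ keepIf-yes (splits? a₀ b₀ d) d (split-exists d∣UV) ⟩
    d ∎)
    where
    open ≡-Reasoning
    a₀ = gcd d U
    b₀ = gcd d V
    gcd≥1 : ∀ n → 1 ≤ gcd d n
    gcd≥1 n = n≢0⇒n>0 (gcd[m,n]≢0 d n (inj₁ (λ d≡0 → <-irrefl (sym d≡0) 1≤d)))
    gcd≤ : ∀ n → 1 ≤ n → gcd d n ≤ n
    gcd≤ n 1≤n = ∣⇒≤ {{>-nonZero 1≤n}} (gcd[m,n]∣n d n)

  sum-over-divisors : 1 ≤ U → 1 ≤ V → ∀ a b → 1 ≤ a → a ≤ U → 1 ≤ b → b ≤ V →
                      rangeSum (U * V) (splitTerm a b) ≡ divisorTerm U a * divisorTerm V b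
  sum-over-divisors 1≤U 1≤V a b 1≤a a≤U 1≤b b≤V = by-cases (a ∣? U) (b ∣? V)
    where
    no-split : ¬ (a ∣ U × b ∣ V) → rangeSum (U * V) (splitTerm a b) ≡ 0
    no-split ¬both = rangeSum-zero (U * V) _ (λ d _ _ →
      keepIf-no (splits? a b d) d (λ (a∣U , b∣V , _) → ¬both (a∣U , b∣V)))

    by-cases : Dec (a ∣ U) → Dec (b ∣ V) → rangeSum (U * V) (splitTerm a b) ≡ divisorTerm U a * divisorTerm V b
    by-cases (yes a∣U) (yes b∣V) = begin
      rangeSum (U * V) (splitTerm a b)
        ≡⟨ rangeSum-single (U * V) (a * b) _ (*-mono-≤ 1≤a 1≤b) (*-mono-≤ a≤U b≤V) (λ d d≢ab →
             keepIf-no (splits? a b d) d (λ (_ , _ , ab≡d) → d≢ab (sym ab≡d))) ⟩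
      splitTerm a b (a * b)
        ≡⟨ keepIf-yes (splits? a b (a * b)) (a * b) (a∣U , b∣V , refl) ⟩
      a * b
        ≡⟨ sym (cong₂ _*_ (keepIf-yes (a ∣? U) a a∣U) (keepIf-yes (b ∣? V) b b∣V)) ⟩
      divisorTerm U a * divisorTerm V b ∎
      where open ≡-Reasoning
    by-cases (no a∤U) _ = trans (no-split (a∤U ∘ proj₁)) (sym (cong (_* divisorTerm V b) (keepIf-no (a ∣? U) a a∤U)))
    by-cases _ (no b∤V) = trans (no-split (b∤V ∘ proj₂))
      (sym (trans (cong (divisorTerm U a *_) (keepIf-no (b ∣? V) b b∤V)) (*-zeroʳ (divisorTerm U a))))

  σ-multiplicative : 1 ≤ U → 1 ≤ V → σ (U * V) ≡ σ U * σ V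
  σ-multiplicative 1≤U 1≤V = begin
    σ (U * V)
      ≡⟨ σ≡rangeSum (U * V) ⟩
    rangeSum (U * V) (divisorTerm (U * V))
      ≡⟨ rangeSum-cong (U * V) (λ d 1≤d _ → sum-over-splits 1≤U 1≤V d 1≤d) ⟩
    rangeSum (U * V) (λ d → rangeSum U (λ a → rangeSum V (λ b → splitTerm a b d)))
      ≡⟨ rangeSum-swap (U * V) U (λ d a → rangeSum V (λ b → splitTerm a b d)) ⟩
    rangeSum U (λ a → rangeSum (U * V) (λ d → rangeSum V (λ b → splitTerm a b d)))
      ≡⟨ rangeSum-cong U (λ a _ _ → rangeSum-swap (U * V) V (λ d b → splitTerm a b d)) ⟩
    rangeSum U (λ a → rangeSum V (λ b → rangeSum (U * V) (splitTerm a b)))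
      ≡⟨ rangeSum-cong U (λ a 1≤a a≤U → rangeSum-cong V (λ b 1≤b b≤V → sum-over-divisors 1≤U 1≤V a b 1≤a a≤U 1≤b b≤V)) ⟩
    rangeSum U (λ a → rangeSum V (λ b → divisorTerm U a * divisorTerm V b))
      ≡⟨ rangeSum-cong U (λ a _ _ → sym (rangeSum-*ˡ V (divisorTerm V) (divisorTerm U a))) ⟩
    rangeSum U (λ a → divisorTerm U a * rangeSum V (divisorTerm V))
      ≡⟨ sym (rangeSum-*ʳ U (divisorTerm U) (rangeSum V (divisorTerm V))) ⟩
    rangeSum U (divisorTerm U) * rangeSum V (divisorTerm V)
      ≡⟨ sym (cong₂ _*_ (σ≡rangeSum U) (σ≡rangeSum V)) ⟩
    σ U * σ V ∎
    where open ≡-Reasoning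

-- A rational
-- r "is the fraction a / d" when toℚᵘ r ≃ a / d in ℚᵘ; such representations are
-- closed under +, * and finite sums, so an equation between rationals can be
-- turned into an equation between natural numbers.

IsFraction : ℚᵘ → ℕ → ℕ → Set
IsFraction r a d = r ℚᵘ.≃ mkℚᵘ (ℤ.+ a) (pred d)

fraction-÷ : ∀ a d → 1 ≤ d → IsFraction (ℚ.toℚᵘ (a ÷ d)) a d
fraction-÷ a (suc d-1) _ = *≡* (begin
  ℚᵘ.↥ (ℚ.toℚᵘ r) ℤ.* ℤ.+ d     ≡⟨ cong (ℤ._* ℤ.+ d) (ℚₚ.↥ᵘ-toℚᵘ r) ⟩
  ℚ.↥ r ℤ.* ℤ.+ d               ≡⟨ cong (ℚ.↥ r ℤ.*_) (sym (ℚₚ.↧-normalize a d)) ⟩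
  ℚ.↥ r ℤ.* (ℚ.↧ r ℤ.* g)     ≡⟨ cong (ℚ.↥ r ℤ.*_) (ℤₚ.*-comm (ℚ.↧ r) g) ⟩
  ℚ.↥ r ℤ.* (g ℤ.* ℚ.↧ r)     ≡⟨ sym (ℤₚ.*-assoc (ℚ.↥ r) g (ℚ.↧ r)) ⟩
  (ℚ.↥ r ℤ.* g) ℤ.* ℚ.↧ r     ≡⟨ cong (ℤ._* ℚ.↧ r) (ℚₚ.↥-normalize a d) ⟩
  ℤ.+ a ℤ.* ℚ.↧ r               ≡⟨ cong (ℤ.+ a ℤ.*_) (sym (ℚₚ.↧ᵘ-toℚᵘ r)) ⟩
  ℤ.+ a ℤ.* ℚᵘ.↧ (ℚ.toℚᵘ r)     ∎)
  where
  open ≡-Reasoning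
  d = suc d-1
  r = ℚ.normalize a d
  g = ℤ.gcd (ℤ.+ a) (ℤ.+ d)

product≥1 : ∀ xs → All (1 ≤_) xs → 1 ≤ product xs
product≥1 []       []         = ≤-refl
product≥1 (x ∷ xs) (1≤x ∷ 1≤xs) = *-mono-≤ 1≤x (product≥1 xs 1≤xs)

Πℕ≥1 : ∀ k B → (∀ i → 1 ≤ B i) → 1 ≤ Πℕ k B
Πℕ≥1 zero    B 1≤B = ≤-refl
Πℕ≥1 (suc k) B 1≤B = *-mono-≤ (1≤B Fin.zero) (Πℕ≥1 k (B ∘ Fin.suc) (1≤B ∘ Fin.suc))

fraction-+ : ∀ {r s a b c d} → IsFraction r a b → IsFraction s c d → 1 ≤ b → 1 ≤ d →
             IsFraction (r ℚᵘ.+ s) (a * d + c * b) (b * d)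
fraction-+ {a = a} {suc b-1} {c} {suc d-1} r≃a/b s≃c/d _ _ =
  ℚᵘₚ.≃-trans (ℚᵘₚ.+-cong r≃a/b s≃c/d) (ℚᵘₚ.≃-reflexive (cong (λ n → mkℚᵘ n (pred (b * d))) numerator))
  where
  b = suc b-1
  d = suc d-1
  numerator : ℤ.+ a ℤ.* ℤ.+ d ℤ.+ ℤ.+ c ℤ.* ℤ.+ b ≡ ℤ.+ (a * d + c * b)
  numerator = trans (cong₂ ℤ._+_ (sym (ℤₚ.pos-* a d)) (sym (ℤₚ.pos-* c b))) (sym (ℤₚ.pos-+ (a * d) (c * b)))

fraction-* : ∀ {r s a b c d} → IsFraction r a b → IsFraction s c d → 1 ≤ b → 1 ≤ d →
             IsFraction (r ℚᵘ.* s) (a * c) (b * d)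
fraction-* {a = a} {suc b-1} {c} {suc d-1} r≃a/b s≃c/d _ _ =
  ℚᵘₚ.≃-trans (ℚᵘₚ.*-cong r≃a/b s≃c/d)
    (ℚᵘₚ.≃-reflexive (cong (λ n → mkℚᵘ n (pred (suc b-1 * suc d-1))) (sym (ℤₚ.pos-* a c))))

fraction-1-1/q : ∀ q → 1 ≤ q → IsFraction (ℚ.toℚᵘ (1ℚ ℚ.- (1 ÷ q))) (pred q) q
fraction-1-1/q (suc q-1) 1≤q =
  ℚᵘₚ.≃-trans (ℚₚ.toℚᵘ-homo-+ 1ℚ (ℚ.- (1 ÷ q)))
  (ℚᵘₚ.≃-trans (ℚᵘₚ.+-congʳ (mkℚᵘ (ℤ.+ 1) 0) (ℚₚ.toℚᵘ-homo‿- (1 ÷ q)))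
  (ℚᵘₚ.≃-trans (ℚᵘₚ.+-congʳ (mkℚᵘ (ℤ.+ 1) 0) (ℚᵘₚ.-‿cong (fraction-÷ 1 q 1≤q)))
  (ℚᵘₚ.≃-trans (*≡* {q = mkℚᵘ (ℤ.+ q-1) (q-1 + 0 * q)} (cancel (ℤ.+ q-1) _))
  (ℚᵘₚ.≃-reflexive (cong (mkℚᵘ (ℤ.+ q-1)) (+-identityʳ q-1))))))
  where
  q = suc q-1
  cancel : ∀ (z w : ℤ.ℤ) → (ℤ.1ℤ ℤ.* (ℤ.1ℤ ℤ.+ z) ℤ.+ ℤ.- ℤ.1ℤ ℤ.* ℤ.1ℤ) ℤ.* w ≡ z ℤ.* w
  cancel = ℤ-Solver.solve-∀

fraction-eulerProduct : ∀ ps → All (1 ≤_) ps →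
  IsFraction (ℚ.toℚᵘ (Πℚ (map (λ p → 1ℚ ℚ.- (1 ÷ p)) ps))) (product (map pred ps)) (product ps)
fraction-eulerProduct []       []         = ℚᵘₚ.≃-refl
fraction-eulerProduct (p ∷ ps) (1≤p ∷ 1≤ps) =
  ℚᵘₚ.≃-trans (ℚₚ.toℚᵘ-homo-* (1ℚ ℚ.- (1 ÷ p)) (Πℚ (map (λ p → 1ℚ ℚ.- (1 ÷ p)) ps)))
    (fraction-* (fraction-1-1/q p 1≤p) (fraction-eulerProduct ps 1≤ps) 1≤p (product≥1 ps 1≤ps))

-- Numerator of Σ_i A i / B i over the common denominator Π_i B i.
crossNum : (k : ℕ) → (Fin k → ℕ) → (Fin k → ℕ) → ℕ
crossNum zero    A B = 0
crossNum (suc k) A B = A Fin.zero * Πℕ k (B ∘ Fin.suc) + crossNum k (A ∘ Fin.suc) (B ∘ Fin.suc) * B Fin.zero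

fraction-Σℚ : ∀ k (t : Fin k → ℚ) A B → (∀ i → IsFraction (ℚ.toℚᵘ (t i)) (A i) (B i)) → (∀ i → 1 ≤ B i) →
              IsFraction (ℚ.toℚᵘ (Σℚ k t)) (crossNum k A B) (Πℕ k B)
fraction-Σℚ zero    t A B t≃A/B 1≤B = ℚᵘₚ.≃-refl
fraction-Σℚ (suc k) t A B t≃A/B 1≤B =
  ℚᵘₚ.≃-trans (ℚₚ.toℚᵘ-homo-+ (t Fin.zero) (Σℚ k (t ∘ Fin.suc)))
    (fraction-+ (t≃A/B Fin.zero) (fraction-Σℚ k (t ∘ Fin.suc) _ _ (t≃A/B ∘ Fin.suc) (1≤B ∘ Fin.suc))
                (1≤B Fin.zero) (Πℕ≥1 k (B ∘ Fin.suc) (1≤B ∘ Fin.suc)))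

fraction≡1 : ∀ {q a d} → IsFraction (ℚ.toℚᵘ q) a d → 1 ≤ d → q ≡ 1ℚ → a ≡ d
fraction≡1 {a = a} {suc d-1} q≃a/d _ refl with ℚᵘₚ.≃-sym q≃a/d
... | *≡* a*1≡1*d = ℤₚ.+-injective (trans (sym (ℤₚ.*-identityʳ (ℤ.+ a))) (trans a*1≡1*d (ℤₚ.*-identityˡ (ℤ.+ suc d-1))))

÷-mono-≤ : ∀ {a b c d} → 1 ≤ b → 1 ≤ d → a * d ≤ c * b → a ÷ b ℚ.≤ c ÷ d
÷-mono-≤ {a} {b@(suc _)} {c} {d@(suc _)} 1≤b 1≤d ad≤cb = ℚₚ.toℚᵘ-cancel-≤
  (ℚᵘₚ.≤-resp₂-≃ .proj₁ (ℚᵘₚ.≃-sym (fraction-÷ c d 1≤d))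
    (ℚᵘₚ.≤-resp₂-≃ .proj₂ (ℚᵘₚ.≃-sym (fraction-÷ a b 1≤b))
      (*≤* (subst₂ ℤ._≤_ (ℤₚ.pos-* a d) (ℤₚ.pos-* c b) (ℤ.+≤+ ad≤cb)))))

÷-mono-< : ∀ {a b c d} → 1 ≤ b → 1 ≤ d → a * d < c * b → a ÷ b ℚ.< c ÷ d
÷-mono-< {a} {b@(suc _)} {c} {d@(suc _)} 1≤b 1≤d ad<cb = ℚₚ.toℚᵘ-cancel-<
  (ℚᵘₚ.<-resp-≃ .proj₁ (ℚᵘₚ.≃-sym (fraction-÷ c d 1≤d))
    (ℚᵘₚ.<-resp-≃ .proj₂ (ℚᵘₚ.≃-sym (fraction-÷ a b 1≤b))
      (*<* (subst₂ ℤ._<_ (ℤₚ.pos-* a d) (ℤₚ.pos-* c b) (ℤ.+<+ ad<cb)))))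

-- Σℚ depends only on the values of its summand (there is no function extensionality).
Σℚ-cong : ∀ k {f g : Fin k → ℚ} → (∀ i → f i ≡ g i) → Σℚ k f ≡ Σℚ k g
Σℚ-cong zero    f≡g = refl
Σℚ-cong (suc k) f≡g = cong₂ ℚ._+_ (f≡g Fin.zero) (Σℚ-cong k (f≡g ∘ Fin.suc))

Σℚ-mono-≤ : ∀ k (f g : Fin k → ℚ) → (∀ i → f i ℚ.≤ g i) → Σℚ k f ℚ.≤ Σℚ k g
Σℚ-mono-≤ zero    f g f≤g = ℚₚ.≤-refl
Σℚ-mono-≤ (suc k) f g f≤g = ℚₚ.+-mono-≤ (f≤g Fin.zero) (Σℚ-mono-≤ k (f ∘ Fin.suc) (g ∘ Fin.suc) (f≤g ∘ Fin.suc))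

Σℚ-mono-< : ∀ k (f g : Fin k → ℚ) → (∀ i → f i ℚ.≤ g i) → (∃ λ i → f i ℚ.< g i) → Σℚ k f ℚ.< Σℚ k g
Σℚ-mono-< (suc k) f g f≤g (Fin.zero , f<g) =
  ℚₚ.+-mono-<-≤ f<g (Σℚ-mono-≤ k (f ∘ Fin.suc) (g ∘ Fin.suc) (f≤g ∘ Fin.suc))
Σℚ-mono-< (suc k) f g f≤g (Fin.suc i , f<g) =
  ℚₚ.+-mono-≤-< (f≤g Fin.zero) (Σℚ-mono-< k (f ∘ Fin.suc) (g ∘ Fin.suc) (f≤g ∘ Fin.suc) (i , f<g))

-- Abundancy of coprime products.  For coprime U, V ≥ 1 we have σ(U·V) = σ(U)·σ(V) and
-- U ≤ σ(U), hence (U·V)/σ(U·V) ≤ V/σ(V), strictly once U ≥ 2.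

1≤σ : ∀ n → 1 ≤ n → 1 ≤ σ n
1≤σ n 1≤n = ≤-trans 1≤n (n≤σ[n] n 1≤n)

module _ {U V : ℕ} (U⊥V : Coprime U V) (1≤U : 1 ≤ U) (1≤V : 1 ≤ V) where

  V*σ[UV] : V * σ (U * V) ≡ σ U * (V * σ V)
  V*σ[UV] = trans (cong (V *_) (σ-multiplicative U⊥V 1≤U 1≤V)) (x∙yz≈y∙xz V (σ U) (σ V))

  abundancy-coprime-≤ : (U * V) ÷ σ (U * V) ℚ.≤ V ÷ σ V
  abundancy-coprime-≤ = ÷-mono-≤ (1≤σ (U * V) (*-mono-≤ 1≤U 1≤V)) (1≤σ V 1≤V)
    (subst₂ _≤_ (sym (*-assoc U V (σ V))) (sym V*σ[UV]) (*-monoˡ-≤ (V * σ V) (n≤σ[n] U 1≤U)))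

  abundancy-coprime-< : 2 ≤ U → (U * V) ÷ σ (U * V) ℚ.< V ÷ σ V
  abundancy-coprime-< 2≤U = ÷-mono-< (1≤σ (U * V) (*-mono-≤ 1≤U 1≤V)) (1≤σ V 1≤V)
    (subst₂ _<_ (sym (*-assoc U V (σ V))) (sym V*σ[UV])
      (*-monoˡ-< (V * σ V) {{>-nonZero (*-mono-≤ 1≤V (1≤σ V 1≤V))}} (n<σ[n] U 2≤U)))

Πℕ>1⇒factor≥2 : ∀ k (U : Fin k → ℕ) → (∀ i → 1 ≤ U i) → 1 < Πℕ k U → ∃ λ i → 2 ≤ U i
Πℕ>1⇒factor≥2 zero    U 1≤U (s≤s ())
Πℕ>1⇒factor≥2 (suc k) U 1≤U 1<ΠU with U Fin.zero ≟ 1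
... | no U₀≢1 = Fin.zero , ≤∧≢⇒< (1≤U Fin.zero) (U₀≢1 ∘ sym)
... | yes U₀≡1 = Product.map Fin.suc id (Πℕ>1⇒factor≥2 k (U ∘ Fin.suc) (1≤U ∘ Fin.suc) 1<ΠU′)
  where
  1<ΠU′ : 1 < Πℕ k (U ∘ Fin.suc)
  1<ΠU′ = subst (1 <_) (trans (cong (_* Πℕ k (U ∘ Fin.suc)) U₀≡1) (*-identityˡ _)) 1<ΠU

harmonious⇒parts-not-harmonious :
  ∀ k (M U V : Fin k → ℕ) → Harmonious k M → (∀ i → 1 ≤ U i) → (∀ i → 1 ≤ V i) →
  (∀ i → M i ≡ U i * V i) → (∀ i → Coprime (U i) (V i)) → (∃ λ i → 2 ≤ U i) →
  Σℚ k (λ i → V i ÷ σ (V i)) ≢ 1ℚ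
harmonious⇒parts-not-harmonious k M U V harmonious 1≤U 1≤V M≡UV U⊥V (i , 2≤Uᵢ) ΣV≡1 =
  ℚₚ.<-irrefl (trans harmonious (sym ΣV≡1)) ΣM<ΣV
  where
  abundancy : ∀ i → M i ÷ σ (M i) ≡ (U i * V i) ÷ σ (U i * V i)
  abundancy i = cong (λ m → m ÷ σ m) (M≡UV i)
  ΣM<ΣV : Σℚ k (λ i → M i ÷ σ (M i)) ℚ.< Σℚ k (λ i → V i ÷ σ (V i))
  ΣM<ΣV = Σℚ-mono-< k _ _
    (λ j → subst (ℚ._≤ _) (sym (abundancy j)) (abundancy-coprime-≤ (U⊥V j) (1≤U j) (1≤V j)))
    (i , subst (ℚ._< _) (sym (abundancy i)) (abundancy-coprime-< (U⊥V i) (1≤U i) (1≤V i) 2≤Uᵢ))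

prime>1 : ∀ {p} → Prime p → 1 < p
prime>1 {p} p-prime = nonTrivial⇒n>1 p {{prime⇒nonTrivial p-prime}}

prime∤1 : ∀ {p} → Prime p → ¬ p ∣ 1
prime∤1 p-prime p∣1 = <-irrefl (sym (∣1⇒≡1 p∣1)) (prime>1 p-prime)

prime∣Πℕ : ∀ k (B : Fin k → ℕ) {p} → Prime p → p ∣ Πℕ k B → ∃ λ i → p ∣ B i
prime∣Πℕ zero    B p-prime p∣1 = ⊥-elim (prime∤1 p-prime p∣1)
prime∣Πℕ (suc k) B p-prime p∣ΠB with euclidsLemma (B Fin.zero) (Πℕ k (B ∘ Fin.suc)) p-prime p∣ΠB
... | inj₁ p∣B₀ = Fin.zero , p∣B₀
... | inj₂ p∣ΠB′ = Product.map Fin.suc id (prime∣Πℕ k (B ∘ Fin.suc) p-prime p∣ΠB′)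

factor∣Πℕ : ∀ k (B : Fin k → ℕ) i → B i ∣ Πℕ k B
factor∣Πℕ (suc k) B Fin.zero    = m∣m*n (Πℕ k (B ∘ Fin.suc))
factor∣Πℕ (suc k) B (Fin.suc i) = ∣n⇒∣m*n (B Fin.zero) (factor∣Πℕ k (B ∘ Fin.suc) i)

prime∣product : ∀ xs {p} → Prime p → p ∣ product xs → ∃ λ x → x ∈ xs × p ∣ x
prime∣product []       p-prime p∣1 = ⊥-elim (prime∤1 p-prime p∣1)
prime∣product (x ∷ xs) p-prime p∣Πxs with euclidsLemma x (product xs) p-prime p∣Πxs
... | inj₁ p∣x   = x , here refl , p∣x
... | inj₂ p∣Πxs′ = Product.map id (Product.map₁ there) (prime∣product xs p-prime p∣Πxs′)

-- p-adic obstruction: if the prime p divides the denominator B i₀ but not its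
-- numerator A i₀, and no other denominator, then p does not divide the cross numerator
-- (while it does divide the common denominator, by factor∣Πℕ).
prime∤crossNum : ∀ k (A B : Fin k → ℕ) {p} (i₀ : Fin k) → Prime p → p ∣ B i₀ →
                 ¬ p ∣ A i₀ → (∀ j → j ≢ i₀ → ¬ p ∣ B j) → ¬ p ∣ crossNum k A B
prime∤crossNum (suc k) A B {p} Fin.zero p-prime p∣B₀ p∤A₀ p∤B p∣N =
  [ p∤A₀ , p∤ΠB′ ]′ (euclidsLemma (A Fin.zero) (Πℕ k (B ∘ Fin.suc)) p-prime p∣A₀ΠB′)
  where
  p∣A₀ΠB′ : p ∣ A Fin.zero * Πℕ k (B ∘ Fin.suc)
  p∣A₀ΠB′ = ∣m+n∣m⇒∣n (subst (p ∣_) (+-comm (A Fin.zero * Πℕ k (B ∘ Fin.suc)) _) p∣N) (∣n⇒∣m*n (crossNum k (A ∘ Fin.suc) (B ∘ Fin.suc)) p∣B₀)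
  p∤ΠB′ : ¬ p ∣ Πℕ k (B ∘ Fin.suc)
  p∤ΠB′ p∣ΠB′ = let (j , p∣Bⱼ) = prime∣Πℕ k (B ∘ Fin.suc) p-prime p∣ΠB′ in p∤B (Fin.suc j) (λ ()) p∣Bⱼ
prime∤crossNum (suc k) A B {p} (Fin.suc i₀) p-prime p∣Bᵢ₀ p∤Aᵢ₀ p∤B p∣N =
  [ p∤N′ , p∤B Fin.zero (λ ()) ]′ (euclidsLemma (crossNum k (A ∘ Fin.suc) (B ∘ Fin.suc)) (B Fin.zero) p-prime p∣N′B₀)
  where
  p∤N′ : ¬ p ∣ crossNum k (A ∘ Fin.suc) (B ∘ Fin.suc)
  p∤N′ = prime∤crossNum k (A ∘ Fin.suc) (B ∘ Fin.suc) i₀ p-prime p∣Bᵢ₀ p∤Aᵢ₀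
           (λ j j≢i₀ → p∤B (Fin.suc j) (j≢i₀ ∘ Finₚ.suc-injective))
  p∣N′B₀ : p ∣ crossNum k (A ∘ Fin.suc) (B ∘ Fin.suc) * B Fin.zero
  p∣N′B₀ = ∣m+n∣m⇒∣n p∣N (∣n⇒∣m*n (A Fin.zero) (∣-trans p∣Bᵢ₀ (factor∣Πℕ k (B ∘ Fin.suc) i₀)))

module _ (S : Pred ℕ 0ℓ) (S? : Decidable S) where

  ∈-primesIn⁻ : ∀ u {p} → p ∈ primesIn S S? u → S p × Prime p × p ∣ u
  ∈-primesIn⁻ u p∈ =
    let (p∈primes , Sp)   = ∈-filter⁻ S? {xs = filter prime? (filter (_∣? u) (map suc (upTo u)))} p∈
        (p∈divisors , pp) = ∈-filter⁻ prime? {xs = filter (_∣? u) (map suc (upTo u))} p∈primes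
        (_ , p∣u)         = ∈-filter⁻ (_∣? u) {xs = map suc (upTo u)} p∈divisors
    in Sp , pp , p∣u

  ∈-primesIn⁺ : ∀ u {p} → 1 ≤ u → S p → Prime p → p ∣ u → p ∈ primesIn S S? u
  ∈-primesIn⁺ u {zero}    1≤u Sp p-prime p∣u with () ← prime>1 p-prime
  ∈-primesIn⁺ u {suc p-1} 1≤u Sp p-prime p∣u =
    ∈-filter⁺ S? (∈-filter⁺ prime? (∈-filter⁺ (_∣? u) (∈-map⁺ suc (∈-upTo⁺ (∣⇒≤ {{>-nonZero 1≤u}} p∣u))) p∣u) p-prime) Sp

  primesIn-primes : ∀ u → All Prime (primesIn S S? u)
  primesIn-primes u = tabulate (proj₁ ∘ proj₂ ∘ ∈-primesIn⁻ u)

  primesIn-empty : (∀ q → ¬ S q) → ∀ u → primesIn S S? u ≡ []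

  eulerFactor-empty : (∀ q → ¬ S q) → ∀ u → eulerFactor S S? u ≡ 1ℚ
  eulerFactor-empty ¬S u = cong (λ ps → Πℚ (map (λ p → 1ℚ ℚ.- (1 ÷ p)) ps)) (primesIn-empty ¬S u)

  primesIn-empty ¬S u = filter-none S? {xs = filter prime? (filter (_∣? u) (map suc (upTo u)))} (universal ¬S _)

largest-in-range : (S : Pred ℕ 0ℓ) → Decidable S → ∀ n →
                   (∀ q → q ≤ n → ¬ S q) ⊎ (∃ λ p → S p × (∀ q → S q → q ≤ n → q ≤ p))
largest-in-range S S? zero with S? zero
... | yes S0 = inj₂ (zero , S0 , λ q _ q≤0 → q≤0)
... | no ¬S0 = inj₁ (λ q q≤0 Sq → ¬S0 (subst S (n≤0⇒n≡0 q≤0) Sq))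
largest-in-range S S? (suc n) with S? (suc n)
... | yes S[1+n] = inj₂ (suc n , S[1+n] , λ q _ q≤1+n → q≤1+n)
... | no ¬S[1+n] = Sum.map extend-none extend-largest (largest-in-range S S? n)
  where
  below : ∀ {q} → q ≤ suc n → S q → q ≤ n
  below q≤1+n Sq = ≤-pred (≤∧≢⇒< q≤1+n (λ q≡1+n → ¬S[1+n] (subst S q≡1+n Sq)))
  extend-none : (∀ q → q ≤ n → ¬ S q) → ∀ q → q ≤ suc n → ¬ S q
  extend-none none q q≤1+n Sq = none q (below q≤1+n Sq) Sq
  extend-largest : (∃ λ p → S p × (∀ q → S q → q ≤ n → q ≤ p)) → ∃ λ p → S p × (∀ q → S q → q ≤ suc n → q ≤ p)
  extend-largest (p , Sp , max) = p , Sp , λ q Sq q≤1+n → max q Sq (below q≤1+n Sq)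

¬∣pred : ∀ {p q} → 2 ≤ q → q ≤ p → ¬ p ∣ pred q
¬∣pred {p} {suc (suc q-2)} (s≤s (s≤s z≤n)) q≤p p∣q-1 = <-irrefl refl (≤-trans q≤p (∣⇒≤ p∣q-1))

-- For the largest
-- prime p ∈ S, say p ∣ U i₀, p divides den i₀ but neither num i₀ (p ∤ V i₀ and
-- 0 < q − 1 < p) nor any other den j (anarchy: p ∣ M i₀ is coprime to M j · σ(M j),
-- which every prime factor of den j divides).
module _ {k} (M U V : Fin k → ℕ) (S : Pred ℕ 0ℓ) (S? : Decidable S) where

  primes : Fin k → List ℕ
  primes i = primesIn S S? (U i)

  primes≥1 : ∀ i → All (1 ≤_) (primes i)
  primes≥1 i = All.map (<⇒≤ ∘ prime>1) (primesIn-primes S S? (U i))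

  num den : Fin k → ℕ
  num i = V i * product (map pred (primes i))
  den i = σ (V i) * product (primes i)

  den≥1 : (∀ i → 1 ≤ V i) → ∀ i → 1 ≤ den i
  den≥1 1≤V i = *-mono-≤ (1≤σ (V i) (1≤V i)) (product≥1 (primes i) (primes≥1 i))

  term-fraction : (∀ i → 1 ≤ V i) → ∀ i →
                  IsFraction (ℚ.toℚᵘ ((V i ÷ σ (V i)) *ℚ eulerFactor S S? (U i))) (num i) (den i)
  term-fraction 1≤V i =
    ℚᵘₚ.≃-trans (ℚₚ.toℚᵘ-homo-* (V i ÷ σ (V i)) (eulerFactor S S? (U i)))
      (fraction-* (fraction-÷ (V i) (σ (V i)) 1≤σV) (fraction-eulerProduct (primes i) (primes≥1 i))
                  1≤σV (product≥1 (primes i) (primes≥1 i)))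
    where
    1≤σV : 1 ≤ σ (V i)
    1≤σV = 1≤σ (V i) (1≤V i)

  prime∣den⇒prime∣Mσ[M] : ∀ j {p} → M j ≡ U j * V j → Coprime (U j) (V j) → 1 ≤ U j → 1 ≤ V j →
                           Prime p → p ∣ den j → p ∣ M j * σ (M j)
  prime∣den⇒prime∣Mσ[M] j M≡UV U⊥V 1≤U 1≤V p-prime p∣den
    with euclidsLemma (σ (V j)) (product (primes j)) p-prime p∣den
  ... | inj₁ p∣σV = ∣n⇒∣m*n (M j) (∣-trans p∣σV σV∣σM)
    where
    σV∣σM : σ (V j) ∣ σ (M j)
    σV∣σM = subst (σ (V j) ∣_) (sym (trans (cong σ M≡UV) (σ-multiplicative U⊥V 1≤U 1≤V))) (n∣m*n (σ (U j)))
  ... | inj₂ p∣Πprimes =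
    let (q , q∈primes , p∣q) = prime∣product (primes j) p-prime p∣Πprimes
        (_ , _ , q∣U)        = ∈-primesIn⁻ S S? (U j) q∈primes
    in ∣m⇒∣m*n (σ (M j)) (subst (_ ∣_) (sym M≡UV) (∣m⇒∣m*n (V j) (∣-trans p∣q q∣U)))

  prime∤num : ∀ i {p} → Coprime (U i) (V i) → Prime p → p ∣ U i → (∀ q → S q → q ≤ p) → ¬ p ∣ num i
  prime∤num i U⊥V p-prime p∣U largest p∣num
    with euclidsLemma (V i) (product (map pred (primes i))) p-prime p∣num
  ... | inj₁ p∣V = <-irrefl (sym (U⊥V (p∣U , p∣V))) (prime>1 p-prime)
  ... | inj₂ p∣Π[q-1] =
    let (x , x∈ , p∣x)        = prime∣product (map pred (primes i)) p-prime p∣Π[q-1]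
        (q , q∈primes , x≡q-1) = ∈-map⁻ pred x∈
        (Sq , q-prime , _)     = ∈-primesIn⁻ S S? (U i) q∈primes
    in ¬∣pred (prime>1 q-prime) (largest q Sq) (subst (_ ∣_) x≡q-1 p∣x)

  largest-prime-obstruction :
    (∀ i j → i ≢ j → gcd (M i) (M j * σ (M j)) ≡ 1) → (∀ i → 1 ≤ U i) → (∀ i → 1 ≤ V i) →
    (∀ i → M i ≡ U i * V i) → (∀ i → Coprime (U i) (V i)) →
    ∀ {p} i₀ → S p → Prime p → p ∣ U i₀ → (∀ q → S q → q ≤ p) →
    Σℚ k (λ i → (V i ÷ σ (V i)) *ℚ eulerFactor S S? (U i)) ≢ 1ℚ
  largest-prime-obstruction anarchy 1≤U 1≤V M≡UV U⊥V {p} i₀ Sp p-prime p∣Uᵢ₀ largest sum≡1 =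
    prime∤crossNum k num den i₀ p-prime p∣denᵢ₀ (prime∤num i₀ (U⊥V i₀) p-prime p∣Uᵢ₀ largest) p∤den p∣N
    where
    N≡D : crossNum k num den ≡ Πℕ k den
    N≡D = fraction≡1 (fraction-Σℚ k _ num den (term-fraction 1≤V) (den≥1 1≤V)) (Πℕ≥1 k den (den≥1 1≤V)) sum≡1
    p∣denᵢ₀ : p ∣ den i₀
    p∣denᵢ₀ = ∣n⇒∣m*n (σ (V i₀)) (∈⇒∣product (∈-primesIn⁺ S S? (U i₀) (1≤U i₀) Sp p-prime p∣Uᵢ₀))
    p∣N : p ∣ crossNum k num den
    p∣N = subst (p ∣_) (sym N≡D) (∣-trans p∣denᵢ₀ (factor∣Πℕ k den i₀))
    p∣Mᵢ₀ : p ∣ M i₀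
    p∣Mᵢ₀ = subst (p ∣_) (sym (M≡UV i₀)) (∣m⇒∣m*n (V i₀) p∣Uᵢ₀)
    p∤den : ∀ j → j ≢ i₀ → ¬ p ∣ den j
    p∤den j j≢i₀ p∣denⱼ = prime∤1 p-prime (subst (p ∣_) (anarchy i₀ j (j≢i₀ ∘ sym))
      (gcd-greatest p∣Mᵢ₀ (prime∣den⇒prime∣Mσ[M] j (M≡UV j) (U⊥V j) (1≤U j) (1≤V j) p-prime p∣denⱼ)))

lemma7 : (k : ℕ) → 2 ≤ k → (M U V : Fin k → ℕ)
       → (∀ i → 1 ≤ M i) → Anarchy k M → Harmonious k M
       → (∀ i → 1 ≤ U i) → (∀ i → 1 ≤ V i)
       → (∀ i → M i ≡ U i * V i) → (∀ i → gcd (U i) (V i) ≡ 1)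
       → 1 < Πℕ k U
       → (S : Pred ℕ 0ℓ) → (S? : Decidable S)
       → (∀ p → S p → Prime p × p ∣ Πℕ k U)
       → ¬ (Σℚ k (λ i → (V i ÷ σ (V i)) *ℚ eulerFactor S S? (U i)) ≡ 1ℚ)
lemma7 k _ M U V _ (_ , anarchy) harmonious 1≤U 1≤V M≡UV gcd≡1 1<ΠU S S? S-primes sum≡1 =
  [ no-prime-in-S , largest-prime-in-S ]′ (largest-in-range S S? (Πℕ k U))
  where
  U⊥V : ∀ i → Coprime (U i) (V i)
  U⊥V i = gcd≡1⇒coprime (gcd≡1 i)

  S≤ΠU : ∀ q → S q → q ≤ Πℕ k U
  S≤ΠU q Sq = ∣⇒≤ {{>-nonZero (<⇒≤ 1<ΠU)}} (proj₂ (S-primes q Sq))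

  no-prime-in-S : (∀ q → q ≤ Πℕ k U → ¬ S q) → ⊥
  no-prime-in-S none = harmonious⇒parts-not-harmonious k M U V harmonious 1≤U 1≤V M≡UV U⊥V
    (Πℕ>1⇒factor≥2 k U 1≤U 1<ΠU)
    (trans (Σℚ-cong k (λ i → sym (euler-trivial i))) sum≡1)
    where
    ¬S : ∀ q → ¬ S q
    ¬S q Sq = none q (S≤ΠU q Sq) Sq
    euler-trivial : ∀ i → (V i ÷ σ (V i)) *ℚ eulerFactor S S? (U i) ≡ V i ÷ σ (V i)
    euler-trivial i = trans (cong ((V i ÷ σ (V i)) *ℚ_) (eulerFactor-empty S S? ¬S (U i))) (ℚₚ.*-identityʳ _)

  largest-prime-in-S : (∃ λ p → S p × (∀ q → S q → q ≤ Πℕ k U → q ≤ p)) → ⊥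
  largest-prime-in-S (p , Sp , largest) =
    let (p-prime , p∣ΠU) = S-primes p Sp
        (i₀ , p∣Uᵢ₀)     = prime∣Πℕ k U p-prime p∣ΠU
    in largest-prime-obstruction M U V S S? anarchy 1≤U 1≤V M≡UV U⊥V i₀ Sp p-prime p∣Uᵢ₀
         (λ q Sq → largest q Sq (S≤ΠU q Sq)) sum≡1
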